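{- Let $G$ be a simple graph with vertex set $\{v_1,\ldots,v_n\}$ and edge cone $\mathbb{R}_+\mathcal{A}$. If $A$ is an independent set of vertices of $G$ and $F=\mathbb{R}_+\mathcal{A}\cap H_A$, then either $F$ is a proper face of $\mathbb{R}_+\mathcal{A}$ or $F=\mathbb{R}_+\mathcal{A}$.
   Context: $e_i$ is the $i$-th unit vector of $\mathbb{R}^n$. The edge cone $\mathbb{R}_+\mathcal{A}$ is the cone of nonnegative real combinations of the vectors $e_i+e_j$ with $\{v_i,v_j\}$ an edge of $G$. A set of vertices is independent if no two of its vertices are adjacent; $N(A)$ is the set of vertices adjacent to some vertex of $A$; $H_A=\{x\in\mathbb{R}^n\mid\sum_{v_i\in A}x_i=\sum_{v_i\in N(A)}x_i\}$. A face of a cone $Q$ is a set $Q\cap H$ where $H$ is a hyperplane through the origin with $Q$ contained in one of the two closed halfspaces bounded by $H$; the faces $Q$ and $\emptyset$ are improper, all others proper. -}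

module Defs where

open import Level using (0ℓ)
open import Data.Nat using (ℕ; zero; suc)
open import Data.Fin using (Fin; zero; suc)
open import Data.Bool using (Bool; true; false; if_then_else_; _∧_; _∨_)
open import Data.Product using (Σ; ∃; _×_; _,_)
open import Data.Sum using (_⊎_)
open import Relation.Nullary using (¬_)
open import Relation.Binary.PropositionalEquality using (_≡_; _≢_)
open import Relation.Binary.Structures using (IsTotalOrder)
open import Algebra.Structures using (IsCommutativeRing)

-- Ordered fields (the scalars; ℝ is the intended instance).
-- The standard library has no real numbers, so we work over an
-- arbitrary ordered field with propositional equality.

record OrderedField : Set₁ where
  infixl 6 _+_
  infixl 7 _*_
  infix  4 _≤_
  field
    Carrier  : Set
    _+_ _*_  : Carrier → Carrier → Carrier
    -_       : Carrier → Carrier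
    0# 1#    : Carrier
    _≤_      : Carrier → Carrier → Set
    isCommutativeRing : IsCommutativeRing _≡_ _+_ _*_ -_ 0# 1#
    isTotalOrder      : IsTotalOrder _≡_ _≤_
    0≢1      : 0# ≢ 1#
    inverse  : ∀ x → x ≢ 0# → ∃ λ y → x * y ≡ 1#
    +-mono-≤ : ∀ {x y} z → x ≤ y → x + z ≤ y + z
    *-nonneg : ∀ {x y} → 0# ≤ x → 0# ≤ y → 0# ≤ x * y

record SimpleGraph (n : ℕ) : Set where
  field
    Adj   : Fin n → Fin n → Bool
    sym   : ∀ i j → Adj i j ≡ Adj j i
    irrefl : ∀ i → Adj i i ≡ false

VSet : ℕ → Set
VSet n = Fin n → Bool

anyFin : ∀ {n} → (Fin n → Bool) → Bool
anyFin {zero}  f = false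
anyFin {suc n} f = f zero ∨ anyFin (λ i → f (suc i))

Independent : ∀ {n} → SimpleGraph n → VSet n → Set
Independent G A =
  ∀ i j → A i ≡ true → A j ≡ true → SimpleGraph.Adj G i j ≡ false

Nbhd : ∀ {n} → SimpleGraph n → VSet n → VSet n
Nbhd G A k = anyFin (λ i → A i ∧ SimpleGraph.Adj G i k)

module _ (K : OrderedField) where
  open OrderedField K

  Vect : ℕ → Set
  Vect n = Fin n → Carrier

  sumFin : ∀ {n} → (Fin n → Carrier) → Carrier
  sumFin {zero}  f = 0#
  sumFin {suc n} f = f zero + sumFin (λ i → f (suc i))

  sumOver : ∀ {n} → VSet n → Vect n → Carrier
  sumOver S x = sumFin (λ i → if S i then x i else 0#)

  dot : ∀ {n} → Vect n → Vect n → Carrier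
  dot a x = sumFin (λ i → a i * x i)

  VecSet : ℕ → Set₁
  VecSet n = Vect n → Set

  _≐_ : ∀ {n} → VecSet n → VecSet n → Set
  P ≐ Q = ∀ x → (P x → Q x) × (Q x → P x)

  -- The edge cone ℝ_+𝒜: nonnegative combinations of e_i + e_j over
  -- edges {v_i,v_j}.  A coefficient λ i j ≥ 0 is attached to each ordered
  -- pair, forced to be 0 on non-edges; then
  --   x = Σ_{i,j} λ i j (e_i + e_j),  i.e.  x_k = Σ_j (λ k j + λ j k).
  EdgeCone : ∀ {n} → SimpleGraph n → VecSet n
  EdgeCone {n} G x =
    Σ (Fin n → Fin n → Carrier) λ c →
      (∀ i j → 0# ≤ c i j) ×
      (∀ i j → SimpleGraph.Adj G i j ≡ false → c i j ≡ 0#) ×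
      (∀ k → x k ≡ sumFin (λ j → c k j + c j k))

  H : ∀ {n} → SimpleGraph n → VSet n → VecSet n
  H G A x = sumOver A x ≡ sumOver (Nbhd G A) x

  IsFace : ∀ {n} → VecSet n → VecSet n → Set
  IsFace {n} Q F =
    Σ (Vect n) λ a →
      (∃ λ i → a i ≢ 0#) ×
      ((∀ x → Q x → 0# ≤ dot a x) ⊎ (∀ x → Q x → dot a x ≤ 0#)) ×
      (F ≐ (λ x → Q x × dot a x ≡ 0#))

  IsProperFace : ∀ {n} → VecSet n → VecSet n → Set
  IsProperFace Q F = IsFace Q F × ¬ (F ≐ Q) × (∃ λ x → F x)

-- Let w be the weight vector with w_k = 1 on N(A), w_k = -1 on A and w_k = 0
-- elsewhere (A and N(A) are disjoint because A is independent), so that H_A is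
-- the hyperplane w·x = 0.  On the generator e_k + e_l of an edge, w takes the
-- value w_k + w_l, which is 0 when the edge meets A (its other end lies in
-- N(A)) and is 0 or positive otherwise.  Hence the edge cone lies in the
-- halfspace w·x ≥ 0.  If every edge generator lies on the hyperplane, so does
-- the whole cone; otherwise some generator is off it while the origin is on it,
-- and the section is a proper face.
module Submission where

open import Level using (0ℓ)
open import Data.Nat using (ℕ)
open import Data.Fin using (Fin; zero; suc; _≟_)
open import Data.Fin.Properties using (any?)
open import Data.Bool using (Bool; true; false; if_then_else_; _∧_; _∨_)
import Data.Bool.Properties as Bool
open import Data.Empty using (⊥-elim)
open import Data.Product using (∃; _×_; _,_; proj₁; proj₂)
open import Data.Sum using (_⊎_; inj₁; inj₂)
open import Function using (_∘_; case_of_)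
open import Relation.Nullary using (¬_; Dec; does; yes; no; _×-dec_)
open import Relation.Binary.PropositionalEquality
open import Relation.Binary.Structures using (IsTotalOrder)
open import Algebra.Structures using (IsCommutativeRing)
open import Algebra.Bundles using (CommutativeRing)
import Algebra.Properties.Ring as RingProperties
import Algebra.Properties.Semiring.Sum as SemiringSum

open import Defs

true≢false : true ≢ false
true≢false ()

anyFin-true : ∀ {n} (f : Fin n → Bool) i → f i ≡ true → anyFin f ≡ true
anyFin-true f zero    fi = cong (_∨ anyFin (λ j → f (suc j))) fi
anyFin-true f (suc i) fi =
  trans (cong (f zero ∨_) (anyFin-true (λ j → f (suc j)) i fi)) (Bool.∨-zeroʳ (f zero))

anyFin-false : ∀ {n} (f : Fin n → Bool) → (∀ i → f i ≡ false) → anyFin f ≡ false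
anyFin-false {ℕ.zero} f _  = refl
anyFin-false {ℕ.suc n} f h = cong₂ _∨_ (h zero) (anyFin-false (λ j → f (suc j)) (λ j → h (suc j)))

module _ (K : OrderedField) where
  open OrderedField K
  open IsCommutativeRing isCommutativeRing
    using ( +-assoc; +-comm; +-identityˡ; +-identityʳ; -‿inverseˡ; -‿inverseʳ
          ; *-comm; *-assoc; *-identityˡ; zeroˡ; zeroʳ; distribˡ; distribʳ)
  open IsTotalOrder isTotalOrder using (total; antisym; reflexive) renaming (refl to ≤-refl; trans to ≤-trans)

  commutativeRing : CommutativeRing 0ℓ 0ℓ
  commutativeRing = record { isCommutativeRing = isCommutativeRing }

  open RingProperties (CommutativeRing.ring commutativeRing)
    using (-1*x≈-x; -‿involutive; -0#≈0#; +-identityˡ-unique)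
  open SemiringSum (CommutativeRing.semiring commutativeRing)
    using (sum; ∑-distrib-+; ∑-comm; *-distribˡ-sum; sum-cong-≗; sum-replicate-zero)

  x≤0⇒0≤-x : ∀ {x} → x ≤ 0# → 0# ≤ - x
  x≤0⇒0≤-x {x} x≤0 = subst₂ _≤_ (-‿inverseʳ x) (+-identityˡ (- x)) (+-mono-≤ (- x) x≤0)

  0≤1 : 0# ≤ 1#
  0≤1 with total 0# 1#
  ... | inj₁ 0≤1 = 0≤1
  ... | inj₂ 1≤0 = subst (0# ≤_) -1*-1≡1 (*-nonneg (x≤0⇒0≤-x 1≤0) (x≤0⇒0≤-x 1≤0))
    where
    -1*-1≡1 : - 1# * - 1# ≡ 1#
    -1*-1≡1 = trans (-1*x≈-x (- 1#)) (-‿involutive 1#)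

  1≢0 : 1# ≢ 0#
  1≢0 1≡0 = 0≢1 (sym 1≡0)

  +-nonneg : ∀ {x y} → 0# ≤ x → 0# ≤ y → 0# ≤ x + y
  +-nonneg {x} {y} 0≤x 0≤y = ≤-trans 0≤x (subst₂ _≤_ (+-identityˡ x) (+-comm y x) (+-mono-≤ x 0≤y))

  +-nonneg-zeroˡ : ∀ {x y} → 0# ≤ x → 0# ≤ y → x + y ≡ 0# → x ≡ 0#
  +-nonneg-zeroˡ {x} {y} 0≤x 0≤y x+y≡0 =
    antisym (subst₂ _≤_ (+-identityˡ x) (trans (+-comm y x) x+y≡0) (+-mono-≤ x 0≤y)) 0≤x

  sumFin≡sum : ∀ {n} (f : Fin n → Carrier) → sumFin K f ≡ sum f
  sumFin≡sum {ℕ.zero}  f = refl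
  sumFin≡sum {ℕ.suc n} f = cong (f zero +_) (sumFin≡sum (λ i → f (suc i)))

  sum-nonneg : ∀ {n} (f : Fin n → Carrier) → (∀ i → 0# ≤ f i) → 0# ≤ sum f
  sum-nonneg {ℕ.zero}  f _ = ≤-refl
  sum-nonneg {ℕ.suc n} f h = +-nonneg (h zero) (sum-nonneg (λ i → f (suc i)) (λ i → h (suc i)))

  sum-zero : ∀ {n} (f : Fin n → Carrier) → (∀ i → f i ≡ 0#) → sum f ≡ 0#
  sum-zero {n} f h = trans (sum-cong-≗ h) (sum-replicate-zero n)

  δ : ∀ {n} → Fin n → Fin n → Carrier
  δ i k = if does (i ≟ k) then 1# else 0#

  δ-nonneg : ∀ {n} (i k : Fin n) → 0# ≤ δ i k
  δ-nonneg i k with does (i ≟ k)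
  ... | true  = 0≤1
  ... | false = ≤-refl

  sum-δ : ∀ {n} (i : Fin n) (f : Fin n → Carrier) → sum (λ k → δ i k * f k) ≡ f i
  sum-δ {ℕ.suc n} zero    f =
    trans (cong₂ _+_ (*-identityˡ (f zero)) (sum-zero _ (λ k → zeroˡ (f (suc k))))) (+-identityʳ (f zero))
  sum-δ {ℕ.suc n} (suc i) f =
    trans (cong₂ _+_ (zeroˡ (f zero)) (sum-δ i (λ k → f (suc k)))) (+-identityˡ (f (suc i)))

  dot-cong : ∀ {n} (w : Vect K n) {x y : Vect K n} → (∀ i → x i ≡ y i) → dot K w x ≡ dot K w y
  dot-cong w {x} {y} x≗y = begin
    dot K w x                ≡⟨ sumFin≡sum (λ i → w i * x i) ⟩
    sum (λ i → w i * x i)    ≡⟨ sum-cong-≗ (λ i → cong (w i *_) (x≗y i)) ⟩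
    sum (λ i → w i * y i)    ≡⟨ sumFin≡sum (λ i → w i * y i) ⟨
    dot K w y                ∎
    where open ≡-Reasoning

  module EdgeConeSection {n} (G : SimpleGraph n) (w : Vect K n) where
    open SimpleGraph G using (Adj)

    conePoint : (Fin n → Fin n → Carrier) → Vect K n
    conePoint c k = sumFin K (λ j → c k j + c j k)

    dot-conePoint : ∀ c → dot K w (conePoint c) ≡ sum (λ k → sum (λ l → c k l * (w k + w l)))
    dot-conePoint c = begin
      dot K w (conePoint c)
        ≡⟨ sumFin≡sum (λ k → w k * conePoint c k) ⟩
      sum (λ k → w k * sumFin K (λ l → c k l + c l k))
        ≡⟨ sum-cong-≗ (λ k → cong (w k *_) (sumFin≡sum (λ l → c k l + c l k))) ⟩
      sum (λ k → w k * sum (λ l → c k l + c l k))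
        ≡⟨ sum-cong-≗ (λ k → *-distribˡ-sum (w k) (λ l → c k l + c l k)) ⟩
      sum (λ k → sum (λ l → w k * (c k l + c l k)))
        ≡⟨ sum-cong-≗ (λ k → sum-cong-≗ (λ l → distribˡ (w k) (c k l) (c l k))) ⟩
      sum (λ k → sum (λ l → w k * c k l + w k * c l k))
        ≡⟨ sum-cong-≗ (λ k → ∑-distrib-+ (λ l → w k * c k l) (λ l → w k * c l k)) ⟩
      sum (λ k → sum (λ l → w k * c k l) + sum (λ l → w k * c l k))
        ≡⟨ ∑-distrib-+ (λ k → sum (λ l → w k * c k l)) (λ k → sum (λ l → w k * c l k)) ⟩
      sum (λ k → sum (λ l → w k * c k l)) + sum (λ k → sum (λ l → w k * c l k))
        ≡⟨ cong (sum (λ k → sum (λ l → w k * c k l)) +_) (∑-comm (λ k l → w k * c l k)) ⟩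
      sum (λ k → sum (λ l → w k * c k l)) + sum (λ l → sum (λ k → w k * c l k))
        ≡⟨ ∑-distrib-+ (λ k → sum (λ l → w k * c k l)) (λ k → sum (λ l → w l * c k l)) ⟨
      sum (λ k → sum (λ l → w k * c k l) + sum (λ l → w l * c k l))
        ≡⟨ sum-cong-≗ (λ k → ∑-distrib-+ (λ l → w k * c k l) (λ l → w l * c k l)) ⟨
      sum (λ k → sum (λ l → w k * c k l + w l * c k l))
        ≡⟨ sum-cong-≗ (λ k → sum-cong-≗ (λ l → trans (cong₂ _+_ (*-comm (w k) (c k l)) (*-comm (w l) (c k l)))
                                                     (sym (distribˡ (c k l) (w k) (w l))))) ⟩
      sum (λ k → sum (λ l → c k l * (w k + w l)))
        ∎
      where open ≡-Reasoning

    EdgeNonneg : Set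
    EdgeNonneg = ∀ k l → Adj k l ≡ true → 0# ≤ w k + w l

    EdgeTight : Set
    EdgeTight = ∀ k l → Adj k l ≡ true → w k + w l ≡ 0#

    edgeCone-dot-nonneg : EdgeNonneg → ∀ x → EdgeCone K G x → 0# ≤ dot K w x
    edgeCone-dot-nonneg nonneg x (c , c≥0 , c-off , x≡) =
      subst (0# ≤_) (sym (trans (dot-cong w x≡) (dot-conePoint c)))
        (sum-nonneg _ (λ k → sum-nonneg _ (λ l → term k l)))
      where
      term : ∀ k l → 0# ≤ c k l * (w k + w l)
      term k l with Adj k l in e
      ... | true  = *-nonneg (c≥0 k l) (nonneg k l e)
      ... | false = reflexive (sym (trans (cong (_* (w k + w l)) (c-off k l e)) (zeroˡ _)))

    edgeCone-dot-zero : EdgeTight → ∀ x → EdgeCone K G x → dot K w x ≡ 0#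
    edgeCone-dot-zero tight x (c , _ , c-off , x≡) =
      trans (dot-cong w x≡) (trans (dot-conePoint c) (sum-zero _ (λ k → sum-zero _ (λ l → term k l))))
      where
      term : ∀ k l → c k l * (w k + w l) ≡ 0#
      term k l with Adj k l in e
      ... | true  = trans (cong (c k l *_) (tight k l e)) (zeroʳ _)
      ... | false = trans (cong (_* (w k + w l)) (c-off k l e)) (zeroˡ _)

    origin : Vect K n
    origin = conePoint (λ _ _ → 0#)

    origin-edgeCone : EdgeCone K G origin
    origin-edgeCone = (λ _ _ → 0#) , (λ _ _ → ≤-refl) , (λ _ _ _ → refl) , (λ _ → refl)

    dot-origin : dot K w origin ≡ 0#
    dot-origin = trans (dot-conePoint (λ _ _ → 0#)) (sum-zero _ (λ k → sum-zero _ (λ l → zeroˡ (w k + w l))))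

    edgeCoeff : Fin n → Fin n → Fin n → Fin n → Carrier
    edgeCoeff i j k l = δ i k * δ j l

    edgeGenerator : Fin n → Fin n → Vect K n
    edgeGenerator i j = conePoint (edgeCoeff i j)

    edgeCoeff-off : ∀ {i j} → Adj i j ≡ true → ∀ k l → Adj k l ≡ false → edgeCoeff i j k l ≡ 0#
    edgeCoeff-off {i} {j} ij k l kl with i ≟ k | j ≟ l
    ... | yes refl | yes refl = ⊥-elim (true≢false (trans (sym ij) kl))
    ... | no _     | _        = zeroˡ _
    ... | yes _    | no _     = zeroʳ _

    edgeGenerator-edgeCone : ∀ {i j} → Adj i j ≡ true → EdgeCone K G (edgeGenerator i j)
    edgeGenerator-edgeCone {i} {j} ij =
      edgeCoeff i j , (λ k l → *-nonneg (δ-nonneg i k) (δ-nonneg j l)) , edgeCoeff-off ij , (λ _ → refl)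

    dot-edgeGenerator : ∀ i j → dot K w (edgeGenerator i j) ≡ w i + w j
    dot-edgeGenerator i j = begin
      dot K w (edgeGenerator i j)
        ≡⟨ dot-conePoint (edgeCoeff i j) ⟩
      sum (λ k → sum (λ l → δ i k * δ j l * (w k + w l)))
        ≡⟨ sum-cong-≗ (λ k → trans (sum-cong-≗ (λ l → *-assoc (δ i k) (δ j l) (w k + w l)))
                                    (sym (*-distribˡ-sum (δ i k) (λ l → δ j l * (w k + w l))))) ⟩
      sum (λ k → δ i k * sum (λ l → δ j l * (w k + w l)))
        ≡⟨ sum-δ i _ ⟩
      sum (λ l → δ j l * (w i + w l))
        ≡⟨ sum-δ j _ ⟩
      w i + w j
        ∎
      where open ≡-Reasoning

    module _ (P : VecSet K n) (P⇔ : _≐_ K P (λ x → dot K w x ≡ 0#)) where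

      Section : VecSet K n
      Section x = EdgeCone K G x × P x

      section-≐-edgeCone : EdgeTight → _≐_ K Section (EdgeCone K G)
      section-≐-edgeCone tight x =
        proj₁ , λ x∈cone → x∈cone , proj₂ (P⇔ x) (edgeCone-dot-zero tight x x∈cone)

      section-isProperFace : (∃ λ i → w i ≢ 0#) → EdgeNonneg →
        ∀ {k l} → Adj k l ≡ true → w k + w l ≢ 0# → IsProperFace K (EdgeCone K G) Section
      section-isProperFace w≢0 nonneg {k} {l} kl wkl≢0 = isFace , ≢cone , (origin , origin∈section)
        where
        isFace : IsFace K (EdgeCone K G) Section
        isFace = w , w≢0 , inj₁ (edgeCone-dot-nonneg nonneg) , λ x →
          (λ (x∈cone , Px) → x∈cone , proj₁ (P⇔ x) Px) ,
          (λ (x∈cone , wx≡0) → x∈cone , proj₂ (P⇔ x) wx≡0)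

        origin∈section : Section origin
        origin∈section = origin-edgeCone , proj₂ (P⇔ origin) dot-origin

        ≢cone : ¬ (_≐_ K Section (EdgeCone K G))
        ≢cone section≐cone = wkl≢0 (trans (sym (dot-edgeGenerator k l)) (proj₁ (P⇔ edge) edge∈P))
          where
          edge = edgeGenerator k l
          edge∈P = proj₂ (proj₂ (section≐cone edge) (edgeGenerator-edgeCone kl))

  module IndependentSetWeight {n} (G : SimpleGraph n) (A : VSet n) (indep : Independent G A) where
    open SimpleGraph G using (Adj)

    N : VSet n
    N = Nbhd G A

    ∈A⇒∉N : ∀ {k} → A k ≡ true → N k ≡ false
    ∈A⇒∉N {k} k∈A = anyFin-false _ notAdj
      where
      notAdj : ∀ i → (A i ∧ Adj i k) ≡ false
      notAdj i with A i in i∈A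
      ... | true  = indep i k i∈A k∈A
      ... | false = refl

    edge-∈A⇒∉A : ∀ {k l} → Adj k l ≡ true → A k ≡ true → A l ≡ false
    edge-∈A⇒∉A {k} {l} kl k∈A with A l in l∈A
    ... | true  = ⊥-elim (true≢false (trans (sym kl) (indep k l k∈A l∈A)))
    ... | false = refl

    edge-∈A⇒∈N : ∀ {k l} → Adj k l ≡ true → A k ≡ true → N l ≡ true
    edge-∈A⇒∈N {k} {l} kl k∈A = anyFin-true (λ i → A i ∧ Adj i l) k (cong₂ _∧_ k∈A kl)

    adj-sym : ∀ {k l} → Adj k l ≡ true → Adj l k ≡ true
    adj-sym {k} {l} kl = trans (SimpleGraph.sym G l k) kl

    ind : Bool → Carrier
    ind b = if b then 1# else 0#

    ind-nonneg : ∀ b → 0# ≤ ind b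
    ind-nonneg true  = 0≤1
    ind-nonneg false = ≤-refl

    ind-+-zero : ∀ a b → (a ∨ b) ≡ false → ind a + ind b ≡ 0#
    ind-+-zero false false _ = +-identityʳ 0#

    ind-+-nonzero : ∀ a b → (a ∨ b) ≡ true → ind a + ind b ≢ 0#
    ind-+-nonzero true  b _ = 1≢0 ∘ +-nonneg-zeroˡ 0≤1 (ind-nonneg b)
    ind-+-nonzero false true _ = 1≢0 ∘ trans (sym (+-identityˡ 1#))

    weight : Vect K n
    weight k = ind (N k) + - ind (A k)

    weight-∉A : ∀ {k} → A k ≡ false → weight k ≡ ind (N k)
    weight-∉A {k} k∉A = trans (cong (λ a → ind (N k) + - ind a) k∉A)
                              (trans (cong (ind (N k) +_) -0#≈0#) (+-identityʳ (ind (N k))))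

    weight-∈A : ∀ {k} → A k ≡ true → weight k ≡ - 1#
    weight-∈A {k} k∈A = trans (cong₂ (λ b a → ind b + - ind a) (∈A⇒∉N k∈A) k∈A) (+-identityˡ (- 1#))

    weight-∈N∖A : ∀ {k} → A k ≡ false → N k ≡ true → weight k ≡ 1#
    weight-∈N∖A k∉A k∈N = trans (weight-∉A k∉A) (cong ind k∈N)

    edgeExcess : Fin n → Fin n → Carrier
    edgeExcess k l = if A k ∨ A l then 0# else ind (N k) + ind (N l)

    -- An edge meeting A joins A to N(A), where the weights -1 and 1 cancel.
    weight-edge : ∀ {k l} → Adj k l ≡ true → weight k + weight l ≡ edgeExcess k l
    weight-edge {k} {l} kl = byMembership (A k) (A l) refl refl
      where
      open ≡-Reasoning
      byMembership : ∀ a b → A k ≡ a → A l ≡ b →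
                     weight k + weight l ≡ (if a ∨ b then 0# else ind (N k) + ind (N l))
      byMembership true _ k∈A _ = begin
        weight k + weight l   ≡⟨ cong₂ _+_ (weight-∈A k∈A)
                                           (weight-∈N∖A (edge-∈A⇒∉A kl k∈A) (edge-∈A⇒∈N kl k∈A)) ⟩
        - 1# + 1#             ≡⟨ -‿inverseˡ 1# ⟩
        0#                    ∎
      byMembership false true k∉A l∈A = begin
        weight k + weight l   ≡⟨ cong₂ _+_ (weight-∈N∖A k∉A (edge-∈A⇒∈N (adj-sym kl) l∈A))
                                           (weight-∈A l∈A) ⟩
        1# + - 1#             ≡⟨ -‿inverseʳ 1# ⟩
        0#                    ∎
      byMembership false false k∉A l∉A = cong₂ _+_ (weight-∉A k∉A) (weight-∉A l∉A)

    weight-edgeNonneg : EdgeConeSection.EdgeNonneg G weight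
    weight-edgeNonneg k l kl with A k ∨ A l | weight-edge kl
    ... | true  | wkl≡0 = reflexive (sym wkl≡0)
    ... | false | wkl≡  = subst (0# ≤_) (sym wkl≡) (+-nonneg (ind-nonneg (N k)) (ind-nonneg (N l)))

    Slack : Fin n → Fin n → Set
    Slack k l = Adj k l ≡ true × (A k ∨ A l) ≡ false × (N k ∨ N l) ≡ true

    slack? : ∀ k l → Dec (Slack k l)
    slack? k l = (Adj k l Bool.≟ true) ×-dec (A k ∨ A l Bool.≟ false) ×-dec (N k ∨ N l Bool.≟ true)

    ¬slack⇒tight : ∀ {k l} → Adj k l ≡ true → ¬ Slack k l → weight k + weight l ≡ 0#
    ¬slack⇒tight {k} {l} kl ¬slack with A k ∨ A l | N k ∨ N l in kl∈N | weight-edge kl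
    ... | true  | _     | wkl≡ = wkl≡
    ... | false | false | wkl≡ = trans wkl≡ (ind-+-zero (N k) (N l) kl∈N)
    ... | false | true  | _    = ⊥-elim (¬slack (kl , refl , refl))

    slack-weight : ∀ {k l} → Slack k l → weight k + weight l ≡ ind (N k) + ind (N l)
    slack-weight {k} {l} (kl , kl∉A , _) =
      trans (weight-edge kl) (cong (λ b → if b then 0# else ind (N k) + ind (N l)) kl∉A)

    slack-nonzero : ∀ {k l} → Slack k l → weight k + weight l ≢ 0#
    slack-nonzero {k} {l} slack@(_ , _ , kl∈N) =
      ind-+-nonzero (N k) (N l) kl∈N ∘ trans (sym (slack-weight slack))

    slack-support : ∀ {k l} → Slack k l → ∃ λ i → weight i ≢ 0#
    slack-support {k} {l} (_ , kl∉A , kl∈N) with N k in k∈N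
    ... | true  = k , 1≢0 ∘ trans (sym (weight-∈N∖A (Bool.∨-conicalˡ (A k) (A l) kl∉A) k∈N))
    ... | false = l , 1≢0 ∘ trans (sym (weight-∈N∖A (Bool.∨-conicalʳ (A k) (A l) kl∉A) kl∈N))

    sumOver-ind : ∀ (S : VSet n) (x : Vect K n) → sumOver K S x ≡ sum (λ i → ind (S i) * x i)
    sumOver-ind S x =
      trans (sumFin≡sum (λ i → if S i then x i else 0#)) (sum-cong-≗ λ i → sym (ind-* (S i) (x i)))
      where
      ind-* : ∀ b y → ind b * y ≡ (if b then y else 0#)
      ind-* true  y = *-identityˡ y
      ind-* false y = zeroˡ y

    dot-weight : ∀ x → dot K weight x + sumOver K A x ≡ sumOver K N x
    dot-weight x = begin
      dot K weight x + sumOver K A x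
        ≡⟨ cong₂ _+_ (sumFin≡sum (λ i → weight i * x i)) (sumOver-ind A x) ⟩
      sum (λ i → weight i * x i) + sum (λ i → ind (A i) * x i)
        ≡⟨ ∑-distrib-+ (λ i → weight i * x i) (λ i → ind (A i) * x i) ⟨
      sum (λ i → weight i * x i + ind (A i) * x i)
        ≡⟨ sum-cong-≗ (λ i → trans (sym (distribʳ (x i) (weight i) (ind (A i))))
                                    (cong (_* x i) (weight-+-ind i))) ⟩
      sum (λ i → ind (N i) * x i)
        ≡⟨ sumOver-ind N x ⟨
      sumOver K N x
        ∎
      where
      open ≡-Reasoning
      weight-+-ind : ∀ i → weight i + ind (A i) ≡ ind (N i)
      weight-+-ind i = trans (+-assoc (ind (N i)) (- ind (A i)) (ind (A i)))
                             (trans (cong (ind (N i) +_) (-‿inverseˡ (ind (A i)))) (+-identityʳ (ind (N i))))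

    H⇔weight : _≐_ K (H K G A) (λ x → dot K weight x ≡ 0#)
    H⇔weight x =
      (λ A≡N → +-identityˡ-unique _ _ (trans (dot-weight x) (sym A≡N))) ,
      (λ w≡0 → trans (sym (+-identityˡ (sumOver K A x)))
                     (trans (cong (_+ sumOver K A x) (sym w≡0)) (dot-weight x)))

lemma3p2 : (K : OrderedField) (n : ℕ) (G : SimpleGraph n) (A : VSet n) →
    Independent G A →
    IsProperFace K (EdgeCone K G) (λ x → EdgeCone K G x × H K G A x)
    ⊎ _≐_ K (λ x → EdgeCone K G x × H K G A x) (EdgeCone K G)
lemma3p2 K n G A indep =
  case any? (λ k → any? (λ l → slack? k l)) of λ where
    (yes (k , l , slack)) → inj₁ (section-isProperFace (H K G A) H⇔weight
                                    (slack-support slack) weight-edgeNonneg (proj₁ slack) (slack-nonzero slack))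
    (no noSlack) → inj₂ (section-≐-edgeCone (H K G A) H⇔weight
                           (λ k l kl → ¬slack⇒tight kl (λ slack → noSlack (k , l , slack))))
  where
  open IndependentSetWeight K G A indep
  open EdgeConeSection K G weight
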